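{- A Boolean relation $R$ is balanced if and only if for every odd $k\ge 1$, $R$ is preserved by the alternating operation of arity $k$.
   Context: A partial Boolean operation of arity $k$ is a map from a subset of $\{0,1\}^k$ to $\{0,1\}$. It is balanced if there are integers $\alpha_1,\ldots,\alpha_k$ (its coefficients) with $\sum_i\alpha_i=1$ such that $(x_1,\ldots,x_k)$ is in its domain iff $\sum_i\alpha_ix_i\in\{0,1\}$, and then $f(x_1,\ldots,x_k)=\sum_i\alpha_ix_i$. The alternating operation of odd arity $k$ is the balanced operation with coefficients $\alpha_1=+1,\alpha_2=-1,\alpha_3=+1,\ldots,\alpha_k=+1$. A partial operation $f$ of arity $k$ preserves $T\subseteq\{0,1\}^m$ if for all $t^1,\ldots,t^k\in T$, whenever all entries of $(f(t^1_1,\ldots,t^k_1),\ldots,f(t^1_m,\ldots,t^k_m))$ are defined, this tuple is in $T$. A Boolean relation is balanced if it is preserved by all balanced operations. -}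

module Defs where

open import Data.Bool using (Bool; true; false)
open import Data.Nat using (ℕ; zero; suc) renaming (_+_ to _+ℕ_)
open import Data.Integer using (ℤ; +_; -_; _+_; _*_)
open import Data.Fin using (Fin; toℕ) renaming (zero to fzero; suc to fsuc)
open import Data.Vec using (Vec; lookup; tabulate)
open import Data.Sum using (_⊎_; inj₁; inj₂)
open import Relation.Binary.PropositionalEquality using (_≡_)
open import Data.Product using (∃)

BoolRel : ℕ → Set₁
BoolRel m = Vec Bool m → Set

b2z : Bool → ℤ
b2z false = + 0
b2z true  = + 1

Σℤ : (k : ℕ) → (Fin k → ℤ) → ℤ
Σℤ zero    f = + 0
Σℤ (suc k) f = f fzero + Σℤ k (λ i → f (fsuc i))

InZeroOne : ℤ → Set
InZeroOne z = (z ≡ + 0) ⊎ (z ≡ + 1)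

toBool : {z : ℤ} → InZeroOne z → Bool
toBool (inj₁ _) = false
toBool (inj₂ _) = true

IsBalancedCoeffs : (k : ℕ) → (Fin k → ℤ) → Set
IsBalancedCoeffs k α = Σℤ k α ≡ + 1

linComb : (k : ℕ) → (Fin k → ℤ) → (Fin k → Bool) → ℤ
linComb k α x = Σℤ k (λ i → α i * b2z (x i))

-- The balanced partial operation with coefficients α preserves R:
-- for all t¹,…,tᵏ ∈ R, if for every coordinate j the value
-- Σ αᵢ tⁱⱼ lies in {0,1} (i.e. f is defined there), then the tuple of
-- these values lies in R.
PreservedBy : {m : ℕ} → BoolRel m → (k : ℕ) → (Fin k → ℤ) → Set
PreservedBy {m} R k α =
  (t : Fin k → Vec Bool m) → (∀ i → R (t i)) →
  (d : (j : Fin m) → InZeroOne (linComb k α (λ i → lookup (t i) j))) →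
  R (tabulate (λ j → toBool (d j)))

IsBalanced : {m : ℕ} → BoolRel m → Set
IsBalanced R = (k : ℕ) (α : Fin k → ℤ) → IsBalancedCoeffs k α → PreservedBy R k α

isEven : ℕ → Bool
isEven zero          = true
isEven (suc zero)    = false
isEven (suc (suc n)) = isEven n

-- Alternating coefficients +1,-1,+1,…  (α₁ = +1, i.e. 0-based index even ↦ +1).
altCoeff : (k : ℕ) → Fin k → ℤ
altCoeff k i with isEven (toℕ i)
... | true  = + 1
... | false = - (+ 1)

Odd : ℕ → Set
Odd k = ∃ (λ n → k ≡ suc (n +ℕ n))

-- (⇒) The alternating coefficients +1,−1,…,+1 of odd arity sum to 1, so the
--     alternating operation is itself balanced.
-- (⇐) Take a balanced operation with coefficients α and tuples t₁,…,t_k ∈ R.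
--     Replace each tᵢ by |αᵢ| copies of itself, placed in a "positive" list P if
--     αᵢ > 0 and in a "negative" list N if αᵢ < 0; then, for every linear weight
--     w, Σ αᵢ w(tᵢ) = Σ_P w − Σ_N w.  Taking w ≡ 1 shows |P| = |N| + 1, so the
--     list p₀ n₀ p₁ n₁ … n_{r−1} p_r of odd length 2r+1 interleaving P and N has
--     the same alternating sum, coordinatewise.  Applying the alternating
--     operation of arity 2r+1 to it yields the required tuple.
module Submission where

open import Defs
open import Data.Nat using (ℕ)
open import Function.Bundles using (_⇔_)

open import Data.Bool using (Bool; true; false)
open import Data.Nat using (zero; suc) renaming (_+_ to _+ℕ_)
open import Data.Nat.Properties using (suc-injective; +-suc)
open import Data.Integer using (ℤ; +_; -_; _+_; _*_; _-_; -[1+_])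
open import Data.Integer.Properties
  using (+-injective; +-identityˡ; +-identityʳ; *-identityˡ; *-identityʳ; neg-distribˡ-*)
open import Data.Integer.Tactic.RingSolver using (solve-∀)
open import Data.Fin using (Fin; toℕ) renaming (zero to fzero; suc to fsuc)
open import Data.Vec using (Vec; lookup; tabulate)
open import Data.Vec.Properties using (tabulate-cong)
open import Data.List using (List; []; _∷_; length; replicate; _++_)
import Data.List as List
open import Data.List.Relation.Unary.All using (All; []; _∷_)
import Data.List.Relation.Unary.All as All
open import Data.List.Relation.Unary.All.Properties using (++⁺; replicate⁺)
open import Data.List.Membership.Propositional.Properties using (∈-lookup)
open import Data.Sum using (inj₁; inj₂)
open import Data.Product using (_×_; _,_)
open import Function using (_∘_; const)
open import Relation.Binary.PropositionalEquality
open import Function.Bundles using (mk⇔)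

open ≡-Reasoning

Σℤ-cong : ∀ k {f g : Fin k → ℤ} → (∀ i → f i ≡ g i) → Σℤ k f ≡ Σℤ k g
Σℤ-cong zero    eq = refl
Σℤ-cong (suc k) eq = cong₂ _+_ (eq fzero) (Σℤ-cong k (eq ∘ fsuc))

Σℤ-neg : ∀ k (f : Fin k → ℤ) → Σℤ k (λ i → - f i) ≡ - Σℤ k f
Σℤ-neg zero    f = refl
Σℤ-neg (suc k) f = begin
  - f fzero + Σℤ k (λ i → - f (fsuc i)) ≡⟨ cong (λ z → - f fzero + z) (Σℤ-neg k (f ∘ fsuc)) ⟩
  - f fzero + - Σℤ k (f ∘ fsuc)         ≡⟨ neg-+ (f fzero) (Σℤ k (f ∘ fsuc)) ⟩
  - (f fzero + Σℤ k (f ∘ fsuc))         ∎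
  where
  neg-+ : ∀ (a b : ℤ) → - a + - b ≡ - (a + b)
  neg-+ = solve-∀

parity-sign : ℕ → ℤ
parity-sign n with isEven n
... | true  = + 1
... | false = - (+ 1)

altCoeff≡parity-sign : ∀ k (i : Fin k) → altCoeff k i ≡ parity-sign (toℕ i)
altCoeff≡parity-sign k i with isEven (toℕ i)
... | true  = refl
... | false = refl

parity-sign-suc : ∀ n → parity-sign (suc n) ≡ - parity-sign n
parity-sign-suc zero          = refl
parity-sign-suc (suc zero)    = refl
parity-sign-suc (suc (suc n)) = parity-sign-suc n

altCoeff-suc : ∀ k (i : Fin k) → altCoeff (suc k) (fsuc i) ≡ - altCoeff k i
altCoeff-suc k i = begin
  altCoeff (suc k) (fsuc i)  ≡⟨ altCoeff≡parity-sign (suc k) (fsuc i) ⟩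
  parity-sign (suc (toℕ i))  ≡⟨ parity-sign-suc (toℕ i) ⟩
  - parity-sign (toℕ i)      ≡⟨ cong -_ (altCoeff≡parity-sign k i) ⟨
  - altCoeff k i             ∎

altΣ : (k : ℕ) → (Fin k → ℤ) → ℤ
altΣ k f = Σℤ k (λ i → altCoeff k i * f i)

altΣ-suc : ∀ k (f : Fin (suc k) → ℤ) → altΣ (suc k) f ≡ f fzero - altΣ k (f ∘ fsuc)
altΣ-suc k f = cong₂ _+_ (*-identityˡ (f fzero)) (begin
  Σℤ k (λ i → altCoeff (suc k) (fsuc i) * f (fsuc i)) ≡⟨ Σℤ-cong k flip-sign ⟩
  Σℤ k (λ i → - (altCoeff k i * f (fsuc i)))           ≡⟨ Σℤ-neg k _ ⟩
  - altΣ k (f ∘ fsuc)                                  ∎)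
  where
  flip-sign : ∀ i → altCoeff (suc k) (fsuc i) * f (fsuc i) ≡ - (altCoeff k i * f (fsuc i))
  flip-sign i = trans (cong (_* f (fsuc i)) (altCoeff-suc k i))
                      (sym (neg-distribˡ-* (altCoeff k i) (f (fsuc i))))

altΣ-one-odd : ∀ n → altΣ (suc (n +ℕ n)) (const (+ 1)) ≡ + 1
altΣ-one-odd zero    = refl
altΣ-one-odd (suc n) rewrite +-suc n n = begin
  altΣ (suc (suc (suc (n +ℕ n)))) (const (+ 1))     ≡⟨ altΣ-suc (suc (suc (n +ℕ n))) (const (+ 1)) ⟩
  + 1 - altΣ (suc (suc (n +ℕ n))) (const (+ 1))     ≡⟨ cong (λ z → + 1 - z) (altΣ-suc (suc (n +ℕ n)) (const (+ 1))) ⟩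
  + 1 - (+ 1 - altΣ (suc (n +ℕ n)) (const (+ 1)))   ≡⟨ cong (λ z → + 1 - (+ 1 - z)) (altΣ-one-odd n) ⟩
  + 1                                               ∎

altCoeff-balanced : ∀ k → Odd k → IsBalancedCoeffs k (altCoeff k)
altCoeff-balanced .(suc (n +ℕ n)) (n , refl) =
  trans (sym (Σℤ-cong k (λ i → *-identityʳ (altCoeff k i)))) (altΣ-one-odd n)
  where
  k = suc (n +ℕ n)

module _ {A : Set} where

  total : (A → ℤ) → List A → ℤ
  total w []       = + 0
  total w (x ∷ xs) = w x + total w xs

  total-++ : ∀ w (xs ys : List A) → total w (xs ++ ys) ≡ total w xs + total w ys
  total-++ w []       ys = sym (+-identityˡ (total w ys))
  total-++ w (x ∷ xs) ys = begin
    w x + total w (xs ++ ys)          ≡⟨ cong (λ z → w x + z) (total-++ w xs ys) ⟩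
    w x + (total w xs + total w ys)   ≡⟨ assoc (w x) (total w xs) (total w ys) ⟩
    w x + total w xs + total w ys     ∎
    where
    assoc : ∀ (a b c : ℤ) → a + (b + c) ≡ a + b + c
    assoc = solve-∀

  total-replicate : ∀ w n (x : A) → total w (replicate n x) ≡ + n * w x
  total-replicate w zero    x = refl
  total-replicate w (suc n) x =
    trans (cong (λ z → w x + z) (total-replicate w n x)) (one-more (w x) (+ n))
    where
    one-more : ∀ (a b : ℤ) → a + b * a ≡ (+ 1 + b) * a
    one-more = solve-∀

  total-one : ∀ (xs : List A) → total (const (+ 1)) xs ≡ + length xs
  total-one []       = refl
  total-one (x ∷ xs) = cong (λ z → + 1 + z) (total-one xs)

  altTotal : (A → ℤ) → List A → ℤ
  altTotal w []       = + 0
  altTotal w (x ∷ xs) = w x - altTotal w xs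

  altΣ-lookup : ∀ w (xs : List A) → altΣ (length xs) (w ∘ List.lookup xs) ≡ altTotal w xs
  altΣ-lookup w []       = refl
  altΣ-lookup w (x ∷ xs) =
    trans (altΣ-suc (length xs) (w ∘ List.lookup (x ∷ xs))) (cong (λ z → w x - z) (altΣ-lookup w xs))

  record Signed : Set where
    constructor _⊖_
    field
      pos neg : List A
  open Signed public

  _⊕_ : Signed → Signed → Signed
  (p ⊖ n) ⊕ (p′ ⊖ n′) = (p ++ p′) ⊖ (n ++ n′)

  value : (A → ℤ) → Signed → ℤ
  value w s = total w (pos s) - total w (neg s)

  AllSigned : (A → Set) → Signed → Set
  AllSigned P s = All P (pos s) × All P (neg s)

  value-⊕ : ∀ w s s′ → value w (s ⊕ s′) ≡ value w s + value w s′
  value-⊕ w (p ⊖ n) (p′ ⊖ n′) = begin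
    total w (p ++ p′) - total w (n ++ n′)
      ≡⟨ cong₂ _-_ (total-++ w p p′) (total-++ w n n′) ⟩
    (total w p + total w p′) - (total w n + total w n′)
      ≡⟨ regroup (total w p) (total w p′) (total w n) (total w n′) ⟩
    (total w p - total w n) + (total w p′ - total w n′) ∎
    where
    regroup : ∀ (a b c d : ℤ) → (a + b) - (c + d) ≡ (a - c) + (b - d)
    regroup = solve-∀

  copies : ℤ → A → Signed
  copies (+ n)    x = replicate n x ⊖ []
  copies -[1+ n ] x = [] ⊖ replicate (suc n) x

  value-copies : ∀ w z (x : A) → value w (copies z x) ≡ z * w x
  value-copies w (+ n)    x = trans (+-identityʳ _) (total-replicate w n x)
  value-copies w -[1+ n ] x = begin
    + 0 - total w (replicate (suc n) x)  ≡⟨ +-identityˡ _ ⟩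
    - total w (replicate (suc n) x)      ≡⟨ cong -_ (total-replicate w (suc n) x) ⟩
    - (+ suc n * w x)                    ≡⟨ neg-distribˡ-* (+ suc n) (w x) ⟩
    -[1+ n ] * w x                       ∎

  expansion : (k : ℕ) → (Fin k → ℤ) → (Fin k → A) → Signed
  expansion zero    α t = [] ⊖ []
  expansion (suc k) α t = copies (α fzero) (t fzero) ⊕ expansion k (α ∘ fsuc) (t ∘ fsuc)

  value-expansion : ∀ w k α (t : Fin k → A) →
    value w (expansion k α t) ≡ Σℤ k (λ i → α i * w (t i))
  value-expansion w zero    α t = refl
  value-expansion w (suc k) α t =
    trans (value-⊕ w (copies (α fzero) (t fzero)) (expansion k (α ∘ fsuc) (t ∘ fsuc)))
          (cong₂ _+_ (value-copies w (α fzero) (t fzero))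
                     (value-expansion w k (α ∘ fsuc) (t ∘ fsuc)))

  all-expansion : ∀ {P : A → Set} k α (t : Fin k → A) → (∀ i → P (t i)) →
    AllSigned P (expansion k α t)
  all-expansion zero    α t pt = [] , []
  all-expansion (suc k) α t pt with α fzero | all-expansion k (α ∘ fsuc) (t ∘ fsuc) (pt ∘ fsuc)
  ... | + n    | ps , ns = ++⁺ (replicate⁺ n (pt fzero)) ps , ns
  ... | -[1+ n ] | ps , ns = ps , ++⁺ (replicate⁺ (suc n) (pt fzero)) ns

  length-expansion : ∀ k α (t : Fin k → A) → IsBalancedCoeffs k α →
    length (pos (expansion k α t)) ≡ suc (length (neg (expansion k α t)))
  length-expansion k α t bal = +-injective (begin
    + length P                        ≡⟨ difference (+ length P) (+ length N) ⟩
    (+ length P - + length N) + + length N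
      ≡⟨ cong (λ z → z + + length N) (sym (cong₂ _-_ (total-one P) (total-one N))) ⟩
    value (const (+ 1)) s + + length N
      ≡⟨ cong (λ z → z + + length N) (value-expansion (const (+ 1)) k α t) ⟩
    Σℤ k (λ i → α i * + 1) + + length N
      ≡⟨ cong (λ z → z + + length N) (trans (Σℤ-cong k (λ i → *-identityʳ (α i))) bal) ⟩
    + suc (length N)                  ∎)
    where
    s = expansion k α t
    P = pos s
    N = neg s
    difference : ∀ (a b : ℤ) → a ≡ (a - b) + b
    difference = solve-∀

  interleave : List A → List A → List A
  interleave (x ∷ xs) (y ∷ ys) = x ∷ y ∷ interleave xs ys
  interleave _        _        = []

  length-interleave : ∀ (xs ys : List A) → length xs ≡ length ys →
    length (interleave xs ys) ≡ length xs +ℕ length ys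
  length-interleave []       []       eq = refl
  length-interleave (x ∷ xs) (y ∷ ys) eq = cong suc (begin
    suc (length (interleave xs ys))    ≡⟨ cong suc (length-interleave xs ys (suc-injective eq)) ⟩
    suc (length xs +ℕ length ys)       ≡⟨ +-suc (length xs) (length ys) ⟨
    length xs +ℕ suc (length ys)       ∎)

  altTotal-interleave : ∀ w (xs ys : List A) → length xs ≡ length ys →
    altTotal w (interleave xs ys) ≡ total w xs - total w ys
  altTotal-interleave w []       []       eq = refl
  altTotal-interleave w (x ∷ xs) (y ∷ ys) eq = begin
    w x - (w y - altTotal w (interleave xs ys))
      ≡⟨ cong (λ z → w x - (w y - z)) (altTotal-interleave w xs ys (suc-injective eq)) ⟩
    w x - (w y - (total w xs - total w ys))
      ≡⟨ regroup (w x) (w y) (total w xs) (total w ys) ⟩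
    (w x + total w xs) - (w y + total w ys) ∎
    where
    regroup : ∀ (a b c d : ℤ) → a - (b - (c - d)) ≡ (a + c) - (b + d)
    regroup = solve-∀

  all-interleave : ∀ {P : A → Set} {xs ys : List A} → All P xs → All P ys →
    All P (interleave xs ys)
  all-interleave (px ∷ pxs) (py ∷ pys) = px ∷ py ∷ all-interleave pxs pys
  all-interleave []         _          = []
  all-interleave (_ ∷ _)    []         = []

toBool-irrelevant : ∀ {z z′ : ℤ} → z ≡ z′ → (p : InZeroOne z) (q : InZeroOne z′) →
  toBool p ≡ toBool q
toBool-irrelevant e (inj₁ _) (inj₁ _) = refl
toBool-irrelevant e (inj₂ _) (inj₂ _) = refl
toBool-irrelevant e (inj₁ z≡0) (inj₂ z′≡1) with trans (sym z≡0) (trans e z′≡1)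
... | ()
toBool-irrelevant e (inj₂ z≡1) (inj₁ z′≡0) with trans (sym z≡1) (trans e z′≡0)
... | ()

readOff-transport : ∀ {m} (R : BoolRel m) {z z′ : Fin m → ℤ} → (∀ j → z j ≡ z′ j) →
  (d : ∀ j → InZeroOne (z j)) →
  ((d′ : ∀ j → InZeroOne (z′ j)) → R (tabulate (toBool ∘ d′))) →
  R (tabulate (toBool ∘ d))
readOff-transport R eq d closed =
  subst R (tabulate-cong (λ j → toBool-irrelevant (sym (eq j)) (d′ j) (d j))) (closed d′)
  where
  d′ = λ j → subst InZeroOne (eq j) (d j)

coord : ∀ {m} → Fin m → Vec Bool m → ℤ
coord j v = b2z (lookup v j)

AltClosed : ∀ {m} → BoolRel m → Set
AltClosed R = (k : ℕ) → Odd k → PreservedBy R k (altCoeff k)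

signed-closure : ∀ {m} (R : BoolRel m) → AltClosed R → (s : Signed) →
  length (pos s) ≡ suc (length (neg s)) → AllSigned R s →
  (d : ∀ j → InZeroOne (value (coord j) s)) → R (tabulate (toBool ∘ d))
signed-closure R closed ((p ∷ ps) ⊖ ns) len (rp ∷ rps , rns) d =
  readOff-transport R same-value d
    (closed (length L) odd (List.lookup L) (λ i → All.lookup rL (∈-lookup i)))
  where
  L = p ∷ interleave ns ps
  rL : All R L
  rL = rp ∷ all-interleave rns rps
  equal-lengths : length ns ≡ length ps
  equal-lengths = sym (suc-injective len)
  odd : Odd (length L)
  odd = length ns , cong suc (trans (length-interleave ns ps equal-lengths)
                                    (cong (length ns +ℕ_) (sym equal-lengths)))
  same-value : ∀ j → value (coord j) ((p ∷ ps) ⊖ ns) ≡ linComb (length L) (altCoeff (length L)) (λ i → lookup (List.lookup L i) j)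
  same-value j = sym (begin
    altΣ (length L) (coord j ∘ List.lookup L)             ≡⟨ altΣ-lookup (coord j) L ⟩
    w p - altTotal w (interleave ns ps)                   ≡⟨ cong (λ z → w p - z) (altTotal-interleave w ns ps equal-lengths) ⟩
    w p - (total w ns - total w ps)                       ≡⟨ regroup (w p) (total w ns) (total w ps) ⟩
    (w p + total w ps) - total w ns                       ∎)
    where
    w = coord j
    regroup : ∀ (a b c : ℤ) → a - (b - c) ≡ (a + c) - b
    regroup = solve-∀

proposition2p4 : {m : ℕ} (R : BoolRel m) →
    IsBalanced R ⇔ ((k : ℕ) → Odd k → PreservedBy R k (altCoeff k))
proposition2p4 R = mk⇔ balanced⇒alt alt⇒balanced
  where
  balanced⇒alt : IsBalanced R → AltClosed R
  balanced⇒alt balanced k odd = balanced k (altCoeff k) (altCoeff-balanced k odd)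

  alt⇒balanced : AltClosed R → IsBalanced R
  alt⇒balanced closed k α bal t tR d =
    readOff-transport R (λ j → sym (value-expansion (coord j) k α t)) d
      (signed-closure R closed (expansion k α t) (length-expansion k α t bal)
                      (all-expansion k α t tR))
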